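{- Let $P\subset\mathbb{R}^n$ be a full-dimensional lattice polytope each of whose facet-defining inequalities has the form $\langle v,x\rangle\le w$ with $v\in\mathbf B_n=\{\pm e_i\}\cup\{\pm e_i\pm e_j: i<j\}$ and $w\in\mathbb{Z}$. Let $Q$ be a maximal cell of the subdivision of $P$ obtained by slicing $P$ with all hyperplanes $\{x_i=k\}$, $1\le i\le n$, $k\in\mathbb{Z}$. Then $Q$ is lattice equivalent to an order polytope.
   Context: For a partial order $\preccurlyeq$ on $\{1,\dots,m\}$, the order polytope is $O(\preccurlyeq)=\{x\in[0,1]^m: x_i\le x_j \text{ whenever } i\preccurlyeq j\}$. Lattice equivalence is equivalence under an affine map preserving the integer lattice.
   Formalization: Stated over ℚ^n instead of $\mathbb{R}^n$: the polytope P, its cells Q, the lattice cubes and the order polytopes are sets of points with rational coordinates. -}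

module Defs where

open import Level using (0ℓ)
open import Data.Nat as ℕ using (ℕ; zero; suc)
open import Data.Integer as ℤ using (ℤ)
open import Data.Rational as ℚ using (ℚ; 0ℚ; 1ℚ; _/_)
open import Data.Fin using (Fin; zero; suc; _<_)
open import Data.Product using (Σ; ∃; _×_; _,_)
open import Data.Sum using (_⊎_)
open import Relation.Binary using (IsPartialOrder)
open import Relation.Binary.PropositionalEquality using (_≡_)
open import Function.Bundles using (_⇔_)

Pt : ℕ → Set
Pt n = Fin n → ℚ

ZVec : ℕ → Set
ZVec n = Fin n → ℤ

ZMat : ℕ → ℕ → Set
ZMat m n = Fin m → Fin n → ℤ

Region : ℕ → Set₁
Region n = Pt n → Set

ι : ℤ → ℚ
ι z = z / 1

Σℚ : ∀ {n} → (Fin n → ℚ) → ℚ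
Σℚ {zero}  f = 0ℚ
Σℚ {suc n} f = f zero ℚ.+ Σℚ (λ i → f (suc i))

Σℤ : ∀ {n} → (Fin n → ℤ) → ℤ
Σℤ {zero}  f = ℤ.+ 0
Σℤ {suc n} f = f zero ℤ.+ Σℤ (λ i → f (suc i))

⟨_,_⟩ : ∀ {n} → ZVec n → Pt n → ℚ
⟨ v , x ⟩ = Σℚ (λ i → ι (v i) ℚ.* x i)

affine : ∀ {n} → ZMat n n → ZVec n → Pt n → Pt n
affine U b x i = ⟨ U i , x ⟩ ℚ.+ ι (b i)

_·_ : ∀ {n} → ZMat n n → ZMat n n → ZMat n n
(U · V) i j = Σℤ (λ k → U i k ℤ.* V k j)

δ : ∀ {n} → Fin n → Fin n → ℤ
δ zero    zero    = ℤ.+ 1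
δ zero    (suc j) = ℤ.+ 0
δ (suc i) zero    = ℤ.+ 0
δ (suc i) (suc j) = δ i j

Unimodular : ∀ {n} → ZMat n n → Set
Unimodular {n} U = Σ (ZMat n n) λ V →
  (∀ i j → (U · V) i j ≡ δ i j) × (∀ i j → (V · U) i j ≡ δ i j)

_≐_ : ∀ {n} → Region n → Region n → Set
_≐_ {n} A B = ∀ (x : Pt n) → A x ⇔ B x

LatticeEquivalent : ∀ {n} → Region n → Region n → Set
LatticeEquivalent {n} A B =
  Σ (ZMat n n) λ U → Σ (ZVec n) λ b →
    Unimodular U × (∀ (x : Pt n) → A x ⇔ B (affine U b x))

OrderPolytope : ∀ {n} → (Fin n → Fin n → Set) → Region n
OrderPolytope _≼_ x =
  (∀ i → (0ℚ ℚ.≤ x i) × (x i ℚ.≤ 1ℚ)) × (∀ i j → i ≼ j → x i ℚ.≤ x j)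

IsOrderPolytopeUpToLattice : ∀ {n} → Region n → Set₁
IsOrderPolytopeUpToLattice {n} A =
  Σ (Fin n → Fin n → Set) λ _≼_ →
    IsPartialOrder _≡_ _≼_ × LatticeEquivalent A (OrderPolytope _≼_)

data Sign : Set where
  plus minus : Sign

sgn : Sign → ℤ
sgn plus  = ℤ.+ 1
sgn minus = ℤ.- (ℤ.+ 1)

e : ∀ {n} → Sign → Fin n → ZVec n
e s i k = sgn s ℤ.* δ i k

InB : ∀ {n} → ZVec n → Set
InB {n} v =
  (Σ Sign λ s → Σ (Fin n) λ i → ∀ k → v k ≡ e s i k)
  ⊎ (Σ Sign λ s → Σ Sign λ t → Σ (Fin n) λ i → Σ (Fin n) λ j →
       (i < j) × (∀ k → v k ≡ e s i k ℤ.+ e t j k))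

HPoly : ∀ {n m} → (Fin m → ZVec n) → (Fin m → ℤ) → Region n
HPoly A w x = ∀ r → ⟨ A r , x ⟩ ℚ.≤ ι (w r)

ConvHull : ∀ {n N} → (Fin N → ZVec n) → Region n
ConvHull {n} {N} p x =
  Σ (Fin N → ℚ) λ λs →
    (∀ a → 0ℚ ℚ.≤ λs a) × (Σℚ λs ≡ 1ℚ) ×
    (∀ i → x i ≡ Σℚ (λ a → λs a ℚ.* ι (p a i)))

IsLatticePolytope : ∀ {n} → Region n → Set
IsLatticePolytope {n} P = Σ ℕ λ N → Σ (Fin N → ZVec n) λ p → P ≐ ConvHull p

FullDim : ∀ {n} → Region n → Set
FullDim {n} S = Σ (Pt n) λ c → Σ ℚ λ ε → (0ℚ ℚ.< ε) ×
  (∀ (y : Pt n) → (∀ i → (c i ℚ.- ε ℚ.< y i) × (y i ℚ.< c i ℚ.+ ε)) → S y)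

Cube : ∀ {n} → ZVec n → Region n
Cube k x = ∀ i → (ι (k i) ℚ.≤ x i) × (x i ℚ.≤ ι (k i) ℚ.+ 1ℚ)

-- cell of the subdivision of P by all hyperplanes x_i = k (k ∈ ℤ)
Cell : ∀ {n} → Region n → ZVec n → Region n
Cell P k x = P x × Cube k x

-- maximal cells = full-dimensional cells
IsMaximalCell : ∀ {n} → Region n → Region n → Set
IsMaximalCell {n} P Q = Σ (ZVec n) λ k → FullDim (Cell P k) × (Q ≐ Cell P k)

module Submission where

-- Reflecting some coordinates maps Cube k onto [0,1]ⁿ by a lattice map
-- y = Φ x.  A facet inequality becomes ±y_i ≤ d or ±y_i ± y_j ≤ d with d ∈ ℤ,
-- and the interior point of Q bounds d from below, so it is redundant on
-- [0,1]ⁿ, a comparison y_a ≤ y_b, or y_i + y_j ≤ 1 / y_i + y_j ≥ 1 through the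
-- centre (classify).  The centre lies in P, hence is a convex combination of
-- lattice points of P, one of which is tight for every facet tight at the
-- centre (supporting-generator); orienting the reflections so that it lies in
-- y ≤ 0 excludes the third case.  Then Φ maps Q onto the order polytope of
-- i ≼ j :⇔ (y_i ≤ y_j on Q), antisymmetric because Q is full-dimensional.

open import Defs
open import Data.Nat using (ℕ)
open import Data.Integer using (ℤ)
open import Data.Fin using (Fin)
open import Data.Product using (_×_)

open import Data.Nat using (zero; suc; z≤n)
open import Data.Integer as ℤ using (+_)
import Data.Integer.Properties as ℤP
open import Data.Rational as ℚ using (ℚ; 0ℚ; 1ℚ; ½)
import Data.Rational.Properties as ℚP
import Data.Rational.Unnormalised as ℚᵘ
import Data.Rational.Unnormalised.Properties as ℚᵘP
open import Data.Fin using (zero; suc)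
import Data.Fin.Properties as FinP
open import Data.Vec.Functional using (updateAt)
open import Data.Vec.Functional.Properties using (updateAt-updates; updateAt-minimal)
open import Data.Product using (Σ; _,_; proj₁; proj₂)
open import Data.Sum using (inj₁; inj₂)
open import Data.Unit using (tt)
open import Data.Empty using (⊥-elim)
open import Relation.Nullary using (¬_; yes; no)
open import Relation.Nullary.Decidable using (decidable-stable)
open import Relation.Binary using (IsPartialOrder)
open import Relation.Binary.PropositionalEquality
open import Function.Bundles using (_⇔_; mk⇔; Equivalence)
open import Data.Rational.Solver using (module +-*-Solver)
open +-*-Solver

open Equivalence using (to; from)

private
  frac : ℤ → ℚᵘ.ℚᵘ
  frac z = ℚᵘ.mkℚᵘ z 0

  ι≃frac : ∀ z → ℚ.toℚᵘ (ι z) ℚᵘ.≃ frac z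
  ι≃frac z = ℚP.toℚᵘ-fromℚᵘ (frac z)

  *1 : ∀ z → z ℤ.* + 1 ≡ z
  *1 = ℤP.*-identityʳ

ι-+ : ∀ a b → ι (a ℤ.+ b) ≡ ι a ℚ.+ ι b
ι-+ a b = ℚP.toℚᵘ-injective (ℚᵘP.≃-trans (ι≃frac (a ℤ.+ b))
  (ℚᵘP.≃-trans (ℚᵘ.*≡* (cong (ℤ._* + 1) (cong₂ ℤ._+_ (sym (*1 a)) (sym (*1 b)))))
    (ℚᵘP.≃-sym (ℚᵘP.≃-trans (ℚP.toℚᵘ-homo-+ (ι a) (ι b)) (ℚᵘP.+-cong (ι≃frac a) (ι≃frac b))))))

ι-* : ∀ a b → ι (a ℤ.* b) ≡ ι a ℚ.* ι b
ι-* a b = ℚP.toℚᵘ-injective (ℚᵘP.≃-trans (ι≃frac (a ℤ.* b)) (ℚᵘP.≃-trans (ℚᵘ.*≡* refl)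
  (ℚᵘP.≃-sym (ℚᵘP.≃-trans (ℚP.toℚᵘ-homo-* (ι a) (ι b)) (ℚᵘP.*-cong (ι≃frac a) (ι≃frac b))))))

ι-neg : ∀ a → ι (ℤ.- a) ≡ ℚ.- ι a
ι-neg a = ℚP.toℚᵘ-injective (ℚᵘP.≃-trans (ι≃frac (ℤ.- a)) (ℚᵘP.≃-trans (ℚᵘ.*≡* refl)
  (ℚᵘP.≃-sym (ℚᵘP.≃-trans (ℚP.toℚᵘ-homo‿- (ι a)) (ℚᵘP.-‿cong (ι≃frac a))))))

ι-- : ∀ a b → ι (a ℤ.- b) ≡ ι a ℚ.- ι b
ι-- a b = trans (ι-+ a (ℤ.- b)) (cong (ι a ℚ.+_) (ι-neg b))

ι-mono-≤ : ∀ {a b} → a ℤ.≤ b → ι a ℚ.≤ ι b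
ι-mono-≤ {a} {b} a≤b = ℚP.toℚᵘ-cancel-≤ (ℚᵘP.≤-respʳ-≃ (ℚᵘP.≃-sym (ι≃frac b))
  (ℚᵘP.≤-respˡ-≃ (ℚᵘP.≃-sym (ι≃frac a)) (ℚᵘ.*≤* (subst₂ ℤ._≤_ (sym (*1 a)) (sym (*1 b)) a≤b))))

ι-cancel-< : ∀ {a b} → ι a ℚ.< ι b → a ℤ.< b
ι-cancel-< {a} {b} ιa<ιb with ℚᵘP.<-respʳ-≃ (ι≃frac b) (ℚᵘP.<-respˡ-≃ (ι≃frac a) (ℚP.toℚᵘ-mono-< ιa<ιb))
... | ℚᵘ.*<* a<b = subst₂ ℤ._<_ (*1 a) (*1 b) a<b

-- Rewriting linear inequalities: two (in)equalities with the same slack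
-- a - b are equivalent.  Every coordinate change below is an instance.

slack-≤ : ∀ {a b c d : ℚ} → a ℚ.- b ≡ c ℚ.- d → a ℚ.≤ b → c ℚ.≤ d
slack-≤ {a} {b} {c} {d} same a≤b = begin
  c                  ≡⟨ solve 2 (λ c d → c := (c :- d) :+ d) refl c d ⟩
  (c ℚ.- d) ℚ.+ d    ≡⟨ cong (ℚ._+ d) (sym same) ⟩
  (a ℚ.- b) ℚ.+ d    ≤⟨ ℚP.+-monoˡ-≤ d (ℚP.+-monoˡ-≤ (ℚ.- b) a≤b) ⟩
  (b ℚ.- b) ℚ.+ d    ≡⟨ solve 2 (λ b d → (b :- b) :+ d := d) refl b d ⟩
  d                  ∎
  where open ℚP.≤-Reasoning

slack-< : ∀ {a b c d : ℚ} → a ℚ.- b ≡ c ℚ.- d → a ℚ.< b → c ℚ.< d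
slack-< {a} {b} {c} {d} same a<b = begin-strict
  c                  ≡⟨ solve 2 (λ c d → c := (c :- d) :+ d) refl c d ⟩
  (c ℚ.- d) ℚ.+ d    ≡⟨ cong (ℚ._+ d) (sym same) ⟩
  (a ℚ.- b) ℚ.+ d    <⟨ ℚP.+-monoˡ-< d (ℚP.+-monoˡ-< (ℚ.- b) a<b) ⟩
  (b ℚ.- b) ℚ.+ d    ≡⟨ solve 2 (λ b d → (b :- b) :+ d := d) refl b d ⟩
  d                  ∎
  where open ℚP.≤-Reasoning

slack-≡ : ∀ {a b c d : ℚ} → a ℚ.- b ≡ c ℚ.- d → a ≡ b → c ≡ d
slack-≡ {a} {b} {c} {d} same a≡b = ℚP.≤-antisym
  (slack-≤ same (ℚP.≤-reflexive a≡b))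
  (slack-≤ (swap same) (ℚP.≤-reflexive (sym a≡b)))
  where
  swap : a ℚ.- b ≡ c ℚ.- d → b ℚ.- a ≡ d ℚ.- c
  swap e = begin
    b ℚ.- a        ≡⟨ solve 2 (λ a b → b :- a := :- (a :- b)) refl a b ⟩
    ℚ.- (a ℚ.- b)  ≡⟨ cong ℚ.-_ e ⟩
    ℚ.- (c ℚ.- d)  ≡⟨ solve 2 (λ c d → :- (c :- d) := d :- c) refl c d ⟩
    d ℚ.- c        ∎
    where open ≡-Reasoning

Σℚ-cong : ∀ {n} {f g : Fin n → ℚ} → (∀ i → f i ≡ g i) → Σℚ f ≡ Σℚ g
Σℚ-cong {zero}  f≡g = refl
Σℚ-cong {suc n} f≡g = cong₂ ℚ._+_ (f≡g zero) (Σℚ-cong (λ i → f≡g (suc i)))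

Σℚ-0 : ∀ {n} {f : Fin n → ℚ} → (∀ i → f i ≡ 0ℚ) → Σℚ f ≡ 0ℚ
Σℚ-0 {zero}  f≡0 = refl
Σℚ-0 {suc n} f≡0 = cong₂ ℚ._+_ (f≡0 zero) (Σℚ-0 (λ i → f≡0 (suc i)))

Σℚ-+ : ∀ {n} (f g : Fin n → ℚ) → Σℚ (λ i → f i ℚ.+ g i) ≡ Σℚ f ℚ.+ Σℚ g
Σℚ-+ {zero}  f g = refl
Σℚ-+ {suc n} f g = begin
  (f zero ℚ.+ g zero) ℚ.+ Σℚ (λ i → f (suc i) ℚ.+ g (suc i))
    ≡⟨ cong (f zero ℚ.+ g zero ℚ.+_) (Σℚ-+ (λ i → f (suc i)) (λ i → g (suc i))) ⟩
  (f zero ℚ.+ g zero) ℚ.+ (F ℚ.+ G)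
    ≡⟨ solve 4 (λ a b c d → (a :+ b) :+ (c :+ d) := (a :+ c) :+ (b :+ d)) refl (f zero) (g zero) F G ⟩
  (f zero ℚ.+ F) ℚ.+ (g zero ℚ.+ G) ∎
  where
  open ≡-Reasoning
  F = Σℚ (λ i → f (suc i))
  G = Σℚ (λ i → g (suc i))

Σℚ-* : ∀ {n} (c : ℚ) (f : Fin n → ℚ) → Σℚ (λ i → c ℚ.* f i) ≡ c ℚ.* Σℚ f
Σℚ-* {zero}  c f = sym (ℚP.*-zeroʳ c)
Σℚ-* {suc n} c f = trans (cong (c ℚ.* f zero ℚ.+_) (Σℚ-* c (λ i → f (suc i))))
                         (sym (ℚP.*-distribˡ-+ c _ _))

Σℚ-swap : ∀ {n N} (F : Fin n → Fin N → ℚ) →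
  Σℚ (λ i → Σℚ (F i)) ≡ Σℚ (λ b → Σℚ (λ i → F i b))
Σℚ-swap {zero} {N} F = sym (Σℚ-0 {N} (λ _ → refl))
Σℚ-swap {suc n} F = trans (cong (Σℚ (F zero) ℚ.+_) (Σℚ-swap (λ i → F (suc i))))
                          (sym (Σℚ-+ (F zero) (λ b → Σℚ (λ i → F (suc i) b))))

Σℚ-δ : ∀ {n} (c : ℤ) (i : Fin n) (f : Fin n → ℚ) →
  Σℚ (λ j → ι (c ℤ.* δ i j) ℚ.* f j) ≡ ι c ℚ.* f i
Σℚ-δ {suc n} c zero f = begin
  ι (c ℤ.* + 1) ℚ.* f zero ℚ.+ Σℚ (λ j → ι (c ℤ.* + 0) ℚ.* f (suc j))
    ≡⟨ cong₂ (λ u v → ι u ℚ.* f zero ℚ.+ v) (ℤP.*-identityʳ c) (Σℚ-0 vanish) ⟩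
  ι c ℚ.* f zero ℚ.+ 0ℚ
    ≡⟨ ℚP.+-identityʳ _ ⟩
  ι c ℚ.* f zero ∎
  where
  open ≡-Reasoning
  vanish : ∀ j → ι (c ℤ.* + 0) ℚ.* f (suc j) ≡ 0ℚ
  vanish j = trans (cong (λ u → ι u ℚ.* f (suc j)) (ℤP.*-zeroʳ c)) (ℚP.*-zeroˡ (f (suc j)))
Σℚ-δ {suc n} c (suc i) f = begin
  ι (c ℤ.* + 0) ℚ.* f zero ℚ.+ Σℚ (λ j → ι (c ℤ.* δ i j) ℚ.* f (suc j))
    ≡⟨ cong₂ ℚ._+_ (trans (cong (λ u → ι u ℚ.* f zero) (ℤP.*-zeroʳ c)) (ℚP.*-zeroˡ (f zero)))
                   (Σℚ-δ c i (λ j → f (suc j))) ⟩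
  0ℚ ℚ.+ ι c ℚ.* f (suc i)
    ≡⟨ ℚP.+-identityˡ _ ⟩
  ι c ℚ.* f (suc i) ∎
  where open ≡-Reasoning

Σℤ-δ : ∀ {n} (c : ℤ) (i : Fin n) (f : Fin n → ℤ) →
  Σℤ (λ j → (c ℤ.* δ i j) ℤ.* f j) ≡ c ℤ.* f i
Σℤ-δ {suc n} c zero f =
  trans (cong₂ ℤ._+_ (cong (ℤ._* f zero) (ℤP.*-identityʳ c)) (vanish (λ j → f (suc j))))
        (ℤP.+-identityʳ _)
  where
  vanish : ∀ {m} (g : Fin m → ℤ) → Σℤ (λ j → (c ℤ.* + 0) ℤ.* g j) ≡ + 0
  vanish {zero}  g = refl
  vanish {suc m} g = cong₂ ℤ._+_ (trans (cong (ℤ._* g zero) (ℤP.*-zeroʳ c)) (ℤP.*-zeroˡ (g zero)))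
                                 (vanish (λ j → g (suc j)))
Σℤ-δ {suc n} c (suc i) f =
  trans (cong (ℤ._+ Σℤ (λ j → (c ℤ.* δ i j) ℤ.* f (suc j)))
              (trans (cong (ℤ._* f zero) (ℤP.*-zeroʳ c)) (ℤP.*-zeroˡ (f zero))))
        (trans (ℤP.+-identityˡ _) (Σℤ-δ c i (λ j → f (suc j))))

Σℚ-nonneg : ∀ {N} (f : Fin N → ℚ) → (∀ b → 0ℚ ℚ.≤ f b) → 0ℚ ℚ.≤ Σℚ f
Σℚ-nonneg {zero}  f f≥0 = ℚP.≤-refl
Σℚ-nonneg {suc N} f f≥0 = ℚP.+-mono-≤ (f≥0 zero) (Σℚ-nonneg (λ b → f (suc b)) (λ b → f≥0 (suc b)))

Σℚ-nonneg-zero : ∀ {N} (f : Fin N → ℚ) → (∀ b → 0ℚ ℚ.≤ f b) → Σℚ f ≡ 0ℚ → ∀ a → f a ≡ 0ℚ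
Σℚ-nonneg-zero {suc N} f f≥0 Σ≡0 zero    = first-vanishes (f≥0 zero) (Σℚ-nonneg _ (λ b → f≥0 (suc b))) Σ≡0
  where
  first-vanishes : ∀ {a b} → 0ℚ ℚ.≤ a → 0ℚ ℚ.≤ b → a ℚ.+ b ≡ 0ℚ → a ≡ 0ℚ
  first-vanishes {a} {b} a≥0 b≥0 a+b≡0 = ℚP.≤-antisym
    (subst₂ ℚ._≤_ (ℚP.+-identityʳ a) a+b≡0 (ℚP.+-monoʳ-≤ a b≥0)) a≥0
Σℚ-nonneg-zero {suc N} f f≥0 Σ≡0 (suc a) =
  Σℚ-nonneg-zero (λ b → f (suc b)) (λ b → f≥0 (suc b)) rest≡0 a
  where
  rest≡0 : Σℚ (λ b → f (suc b)) ≡ 0ℚ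
  rest≡0 = ℚP.≤-antisym
    (subst₂ ℚ._≤_ (ℚP.+-identityˡ _) Σ≡0 (ℚP.+-monoˡ-≤ (Σℚ (λ b → f (suc b))) (f≥0 zero)))
    (Σℚ-nonneg _ (λ b → f≥0 (suc b)))

positive-weight : ∀ {N} (weight : Fin N → ℚ) → (∀ b → 0ℚ ℚ.≤ weight b) → Σℚ weight ≡ 1ℚ →
  Σ (Fin N) λ a → 0ℚ ℚ.< weight a
positive-weight {zero}  weight _ ()
positive-weight {suc N} weight w≥0 Σ≡1 with 0ℚ ℚP.<? weight zero
... | yes w₀>0 = zero , w₀>0
... | no  w₀≯0 with positive-weight (λ b → weight (suc b)) (λ b → w≥0 (suc b)) rest≡1
  where
  rest≡1 : Σℚ (λ b → weight (suc b)) ≡ 1ℚ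
  rest≡1 = trans (sym (ℚP.+-identityˡ _))
    (trans (cong (ℚ._+ Σℚ (λ b → weight (suc b))) (sym (ℚP.≤-antisym (ℚP.≮⇒≥ w₀≯0) (w≥0 zero)))) Σ≡1)
... | a , wₐ>0 = suc a , wₐ>0

convex-tight : ∀ {N} (weight h : Fin N → ℚ) (W : ℚ) →
  (∀ b → 0ℚ ℚ.≤ weight b) → Σℚ weight ≡ 1ℚ → (∀ b → h b ℚ.≤ W) →
  Σℚ (λ b → weight b ℚ.* h b) ≡ W → ∀ a → 0ℚ ℚ.< weight a → h a ≡ W
convex-tight weight h W w≥0 Σw≡1 h≤W Σwh≡W a wₐ>0 =
  slack-≡ (solve 2 (λ W h → con 0ℚ :- (W :- h) := h :- W) refl W (h a)) (sym gapₐ≡0)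
  where
  gap : Fin _ → ℚ
  gap b = weight b ℚ.* (W ℚ.- h b)
  gap≥0 : ∀ b → 0ℚ ℚ.≤ gap b
  gap≥0 b = subst (ℚ._≤ gap b) (ℚP.*-zeroʳ (weight b))
    (ℚP.*-monoˡ-≤-nonNeg (weight b) {{ℚ.nonNegative (w≥0 b)}}
      (slack-≤ (solve 2 (λ h W → h :- W := con 0ℚ :- (W :- h)) refl (h b) W) (h≤W b)))
  Σgap≡0 : Σℚ gap ≡ 0ℚ
  Σgap≡0 = begin
    Σℚ gap
      ≡⟨ Σℚ-cong (λ b → solve 3 (λ l W h → l :* (W :- h) := W :* l :+ con (ℚ.- 1ℚ) :* (l :* h)) refl (weight b) W (h b)) ⟩
    Σℚ (λ b → W ℚ.* weight b ℚ.+ (ℚ.- 1ℚ) ℚ.* (weight b ℚ.* h b))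
      ≡⟨ Σℚ-+ (λ b → W ℚ.* weight b) (λ b → (ℚ.- 1ℚ) ℚ.* (weight b ℚ.* h b)) ⟩
    Σℚ (λ b → W ℚ.* weight b) ℚ.+ Σℚ (λ b → (ℚ.- 1ℚ) ℚ.* (weight b ℚ.* h b))
      ≡⟨ cong₂ ℚ._+_ (Σℚ-* W weight) (Σℚ-* (ℚ.- 1ℚ) (λ b → weight b ℚ.* h b)) ⟩
    W ℚ.* Σℚ weight ℚ.+ (ℚ.- 1ℚ) ℚ.* Σℚ (λ b → weight b ℚ.* h b)
      ≡⟨ cong₂ (λ u v → W ℚ.* u ℚ.+ (ℚ.- 1ℚ) ℚ.* v) Σw≡1 Σwh≡W ⟩
    W ℚ.* 1ℚ ℚ.+ (ℚ.- 1ℚ) ℚ.* W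
      ≡⟨ solve 1 (λ W → W :* con 1ℚ :+ con (ℚ.- 1ℚ) :* W := con 0ℚ) refl W ⟩
    0ℚ ∎
    where open ≡-Reasoning
  gapₐ≡0 : W ℚ.- h a ≡ 0ℚ
  gapₐ≡0 = ℚP.≤-antisym
    (ℚP.*-cancelˡ-≤-pos (weight a) {{ℚ.positive wₐ>0}} (ℚP.≤-reflexive (trans gapₐ-vanishes (sym (ℚP.*-zeroʳ (weight a))))))
    (ℚP.*-cancelˡ-≤-pos (weight a) {{ℚ.positive wₐ>0}} (ℚP.≤-reflexive (trans (ℚP.*-zeroʳ (weight a)) (sym gapₐ-vanishes))))
    where
    gapₐ-vanishes : gap a ≡ 0ℚ
    gapₐ-vanishes = Σℚ-nonneg-zero gap gap≥0 Σgap≡0 a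

⟨⟩-cong : ∀ {n} (v : ZVec n) {x y : Pt n} → (∀ i → x i ≡ y i) → ⟨ v , x ⟩ ≡ ⟨ v , y ⟩
⟨⟩-cong v x≡y = Σℚ-cong (λ i → cong (ι (v i) ℚ.*_) (x≡y i))

⟨⟩-combination : ∀ {n N} (v : ZVec n) (weight : Fin N → ℚ) (g : Fin N → Pt n) →
  ⟨ v , (λ i → Σℚ (λ b → weight b ℚ.* g b i)) ⟩ ≡ Σℚ (λ b → weight b ℚ.* ⟨ v , g b ⟩)
⟨⟩-combination v weight g = begin
  Σℚ (λ i → ι (v i) ℚ.* Σℚ (λ b → weight b ℚ.* g b i))
    ≡⟨ Σℚ-cong (λ i → sym (Σℚ-* (ι (v i)) (λ b → weight b ℚ.* g b i))) ⟩
  Σℚ (λ i → Σℚ (λ b → ι (v i) ℚ.* (weight b ℚ.* g b i)))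
    ≡⟨ Σℚ-swap (λ i b → ι (v i) ℚ.* (weight b ℚ.* g b i)) ⟩
  Σℚ (λ b → Σℚ (λ i → ι (v i) ℚ.* (weight b ℚ.* g b i)))
    ≡⟨ Σℚ-cong (λ b → trans (Σℚ-cong (λ i → reorder (ι (v i)) (weight b) (g b i)))
                            (Σℚ-* (weight b) (λ i → ι (v i) ℚ.* g b i))) ⟩
  Σℚ (λ b → weight b ℚ.* ⟨ v , g b ⟩) ∎
  where
  open ≡-Reasoning
  reorder : ∀ u l x → u ℚ.* (l ℚ.* x) ≡ l ℚ.* (u ℚ.* x)
  reorder = solve 3 (λ u l x → u :* (l :* x) := l :* (u :* x)) refl

lattice-point : ∀ {n} → ZVec n → Pt n
lattice-point z i = ι (z i)

-- Every generator lies in the convex hull (weights: a Kronecker delta).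
generator∈hull : ∀ {n N} (p : Fin N → ZVec n) (a : Fin N) → ConvHull p (lattice-point (p a))
generator∈hull p a = weight , weight≥0 , Σweight≡1 , coordinates
  where
  weight : Fin _ → ℚ
  weight b = ι (δ a b)
  unit-scale : ∀ b x → ι (δ a b) ℚ.* x ≡ ι (+ 1 ℤ.* δ a b) ℚ.* x
  unit-scale b x = cong (λ u → ι u ℚ.* x) (sym (ℤP.*-identityˡ (δ a b)))
  δ≥0 : ∀ {N} (a b : Fin N) → + 0 ℤ.≤ δ a b
  δ≥0 zero    zero    = ℤ.+≤+ z≤n
  δ≥0 zero    (suc b) = ℤ.+≤+ z≤n
  δ≥0 (suc a) zero    = ℤ.+≤+ z≤n
  δ≥0 (suc a) (suc b) = δ≥0 a b
  weight≥0 : ∀ b → 0ℚ ℚ.≤ weight b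
  weight≥0 b = ι-mono-≤ (δ≥0 a b)
  Σweight≡1 : Σℚ weight ≡ 1ℚ
  Σweight≡1 = trans (Σℚ-cong (λ b → trans (sym (ℚP.*-identityʳ (weight b))) (unit-scale b 1ℚ)))
                    (Σℚ-δ (+ 1) a (λ _ → 1ℚ))
  coordinates : ∀ i → ι (p a i) ≡ Σℚ (λ b → weight b ℚ.* ι (p b i))
  coordinates i = sym (trans (Σℚ-cong (λ b → unit-scale b (ι (p b i))))
                             (trans (Σℚ-δ (+ 1) a (λ b → ι (p b i))) (ℚP.*-identityˡ _)))

-- Supporting generator: a point x of P = conv(p) has a generator p a such
-- that every linear inequality valid on P and tight at x is tight at p a
-- (take any generator of positive weight in a representation of x).
supporting-generator : ∀ {n N} {P : Region n} (p : Fin N → ZVec n) → P ≐ ConvHull p →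
  ∀ {x} → P x → Σ (Fin N) λ a → ∀ (v : ZVec n) (W : ℚ) →
    (∀ y → P y → ⟨ v , y ⟩ ℚ.≤ W) → ⟨ v , x ⟩ ≡ W → ⟨ v , lattice-point (p a) ⟩ ≡ W
supporting-generator p P≐hull {x} x∈P with to (P≐hull x) x∈P
... | weight , weight≥0 , Σweight≡1 , x≡Σ with positive-weight weight weight≥0 Σweight≡1
...   | a , wₐ>0 = a , λ v W valid tight → convex-tight weight (λ b → ⟨ v , lattice-point (p b) ⟩) W
  weight≥0 Σweight≡1
  (λ b → valid _ (from (P≐hull _) (generator∈hull p b)))
  (trans (sym (⟨⟩-combination v weight (λ b → lattice-point (p b)))) (trans (sym (⟨⟩-cong v x≡Σ)) tight))
  a wₐ>0

sg : Sign → ℚ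
sg s = ι (sgn s)

_⊗_ : Sign → Sign → Sign
plus  ⊗ t     = t
minus ⊗ plus  = minus
minus ⊗ minus = plus

sg-⊗ : ∀ s t → sg (s ⊗ t) ≡ sg s ℚ.* sg t
sg-⊗ plus  plus  = refl
sg-⊗ plus  minus = refl
sg-⊗ minus plus  = refl
sg-⊗ minus minus = refl

sgn-involutive : ∀ s z → sgn s ℤ.* (sgn s ℤ.* z) ≡ z
sgn-involutive s z = trans (sym (ℤP.*-assoc (sgn s) (sgn s) z)) (trans (cong (ℤ._* z) (sgn² s)) (ℤP.*-identityˡ z))
  where
  sgn² : ∀ s → sgn s ℤ.* sgn s ≡ + 1
  sgn² plus  = refl
  sgn² minus = refl

data Form (n : ℕ) : Set where
  single : Sign → Fin n → Form n
  double : Sign → Sign → Fin n → Fin n → Form n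

val : ∀ {n} → Form n → Pt n → ℚ
val (single s i)     x = sg s ℚ.* x i
val (double s t i j) x = sg s ℚ.* x i ℚ.+ sg t ℚ.* x j

valℤ : ∀ {n} → Form n → ZVec n → ℤ
valℤ (single s i)     z = sgn s ℤ.* z i
valℤ (double s t i j) z = sgn s ℤ.* z i ℤ.+ sgn t ℤ.* z j

val-cong : ∀ {n} (f : Form n) {x y : Pt n} → (∀ i → x i ≡ y i) → val f x ≡ val f y
val-cong (single s i)     x≡y = cong (sg s ℚ.*_) (x≡y i)
val-cong (double s t i j) x≡y = cong₂ (λ u v → sg s ℚ.* u ℚ.+ sg t ℚ.* v) (x≡y i) (x≡y j)

val-lattice : ∀ {n} (f : Form n) (z : ZVec n) → val f (lattice-point z) ≡ ι (valℤ f z)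
val-lattice (single s i)     z = sym (ι-* (sgn s) (z i))
val-lattice (double s t i j) z =
  sym (trans (ι-+ (sgn s ℤ.* z i) (sgn t ℤ.* z j)) (cong₂ ℚ._+_ (ι-* (sgn s) (z i)) (ι-* (sgn t) (z j))))

⟨e⟩ : ∀ {n} s (i : Fin n) (x : Pt n) → ⟨ e s i , x ⟩ ≡ sg s ℚ.* x i
⟨e⟩ s i x = Σℚ-δ (sgn s) i x

form : ∀ {n} {v : ZVec n} → InB v → Form n
form (inj₁ (s , i , _))             = single s i
form (inj₂ (s , t , i , j , _ , _)) = double s t i j

form-val : ∀ {n} {v : ZVec n} (v∈B : InB v) (x : Pt n) → ⟨ v , x ⟩ ≡ val (form v∈B) x
form-val (inj₁ (s , i , v≡e)) x =
  trans (Σℚ-cong (λ l → cong (λ u → ι u ℚ.* x l) (v≡e l))) (⟨e⟩ s i x)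
form-val {v = v} (inj₂ (s , t , i , j , _ , v≡e+e)) x = begin
  Σℚ (λ l → ι (v l) ℚ.* x l)
    ≡⟨ Σℚ-cong (λ l → trans (cong (λ u → ι u ℚ.* x l) (v≡e+e l))
                            (trans (cong (ℚ._* x l) (ι-+ (e s i l) (e t j l)))
                                   (ℚP.*-distribʳ-+ (x l) (ι (e s i l)) (ι (e t j l))))) ⟩
  Σℚ (λ l → ι (e s i l) ℚ.* x l ℚ.+ ι (e t j l) ℚ.* x l)
    ≡⟨ Σℚ-+ (λ l → ι (e s i l) ℚ.* x l) (λ l → ι (e t j l) ℚ.* x l) ⟩
  ⟨ e s i , x ⟩ ℚ.+ ⟨ e t j , x ⟩
    ≡⟨ cong₂ ℚ._+_ (⟨e⟩ s i x) (⟨e⟩ t j x) ⟩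
  sg s ℚ.* x i ℚ.+ sg t ℚ.* x j ∎
  where open ≡-Reasoning

twist : ∀ {n} → (Fin n → Sign) → Form n → Form n
twist σ (single s i)     = single (s ⊗ σ i) i
twist σ (double s t i j) = double (s ⊗ σ i) (t ⊗ σ j) i j

val-twist : ∀ {n} (f : Form n) (σ : Fin n → Sign) (c y : Pt n) →
  val f (λ i → c i ℚ.+ sg (σ i) ℚ.* y i) ≡ val f c ℚ.+ val (twist σ f) y
val-twist (single s i) σ c y =
  trans (solve 4 (λ a b c y → a :* (c :+ b :* y) := a :* c :+ a :* b :* y) refl (sg s) (sg (σ i)) (c i) (y i))
        (cong (λ u → sg s ℚ.* c i ℚ.+ u ℚ.* y i) (sym (sg-⊗ s (σ i))))
val-twist (double s t i j) σ c y =
  trans (solve 8 (λ a b a' b' c c' y y' →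
                    a :* (c :+ a' :* y) :+ b :* (c' :+ b' :* y')
                    := (a :* c :+ b :* c') :+ (a :* a' :* y :+ b :* b' :* y'))
               refl (sg s) (sg t) (sg (σ i)) (sg (σ j)) (c i) (c j) (y i) (y j))
        (cong₂ (λ u v → sg s ℚ.* c i ℚ.+ sg t ℚ.* c j ℚ.+ (u ℚ.* y i ℚ.+ v ℚ.* y j))
               (sym (sg-⊗ s (σ i))) (sym (sg-⊗ t (σ j))))

UnitCube : ∀ {n} → Pt n → Set
UnitCube y = ∀ i → (0ℚ ℚ.≤ y i) × (y i ℚ.≤ 1ℚ)

OpenUnitCube : ∀ {n} → Pt n → Set
OpenUnitCube y = ∀ i → (0ℚ ℚ.< y i) × (y i ℚ.< 1ℚ)

half : ∀ {n} → Pt n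
half _ = ½

-- low s = min { sg s · t : t ∈ [0,1] }
low : Sign → ℤ
low plus  = + 0
low minus = ℤ.- + 1

-- The minimum lo f and maximum hi f of a form over the unit cube.
lo : ∀ {n} → Form n → ℤ
lo (single s i)     = low s
lo (double s t i j) = low s ℤ.+ low t

hi : ∀ {n} → Form n → ℤ
hi (single s i)     = ℤ.suc (low s)
hi (double s t i j) = ℤ.suc (ℤ.suc (low s ℤ.+ low t))

term-open : ∀ s {t} → 0ℚ ℚ.< t → t ℚ.< 1ℚ → ι (low s) ℚ.< sg s ℚ.* t
term-open plus  {t} 0<t _   = subst (0ℚ ℚ.<_) (sym (ℚP.*-identityˡ t)) 0<t
term-open minus {t} _   t<1 = slack-< (solve 1 (λ t → t :- con 1ℚ := con (ℚ.- 1ℚ) :- con (ℚ.- 1ℚ) :* t) refl t) t<1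

term-closed : ∀ s {t} → 0ℚ ℚ.≤ t → t ℚ.≤ 1ℚ → sg s ℚ.* t ℚ.≤ ι (ℤ.suc (low s))
term-closed plus  {t} _   t≤1 = subst (ℚ._≤ 1ℚ) (sym (ℚP.*-identityˡ t)) t≤1
term-closed minus {t} 0≤t _   = slack-≤ (solve 1 (λ t → con 0ℚ :- t := con (ℚ.- 1ℚ) :* t :- con 0ℚ) refl t) 0≤t

val-open : ∀ {n} (f : Form n) {z : Pt n} → OpenUnitCube z → ι (lo f) ℚ.< val f z
val-open (single s i)     z∈ = term-open s (proj₁ (z∈ i)) (proj₂ (z∈ i))
val-open (double s t i j) {z} z∈ = subst (ℚ._< sg s ℚ.* z i ℚ.+ sg t ℚ.* z j) (sym (ι-+ (low s) (low t)))
  (ℚP.+-mono-< (term-open s (proj₁ (z∈ i)) (proj₂ (z∈ i))) (term-open t (proj₁ (z∈ j)) (proj₂ (z∈ j))))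

val-closed : ∀ {n} (f : Form n) {y : Pt n} → UnitCube y → val f y ℚ.≤ ι (hi f)
val-closed (single s i)     y∈ = term-closed s (proj₁ (y∈ i)) (proj₂ (y∈ i))
val-closed (double s t i j) y∈ = ℚP.≤-trans
  (ℚP.+-mono-≤ (term-closed s (proj₁ (y∈ i)) (proj₂ (y∈ i))) (term-closed t (proj₁ (y∈ j)) (proj₂ (y∈ j))))
  (ℚP.≤-reflexive (maxima-add s t))
  where
  maxima-add : ∀ s t → ι (ℤ.suc (low s)) ℚ.+ ι (ℤ.suc (low t)) ≡ ι (ℤ.suc (ℤ.suc (low s ℤ.+ low t)))
  maxima-add plus  plus  = refl
  maxima-add plus  minus = refl
  maxima-add minus plus  = refl
  maxima-add minus minus = refl

-- At the centre a form takes the value lo f + 1 (doubles) or lo f + ½ (singles).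
val-half : ∀ {n} (f : Form n) → val f half ℚ.≤ ι (ℤ.suc (lo f))
val-half (single plus  i)     = ℚP.≤ᵇ⇒≤ tt
val-half (single minus i)     = ℚP.≤ᵇ⇒≤ tt
val-half (double plus  plus  i j) = ℚP.≤-refl
val-half (double plus  minus i j) = ℚP.≤-refl
val-half (double minus plus  i j) = ℚP.≤-refl
val-half (double minus minus i j) = ℚP.≤-refl

interior-bound : ∀ {n} (f : Form n) {z : Pt n} {d : ℤ} →
  OpenUnitCube z → val f z ℚ.≤ ι d → ℤ.suc (lo f) ℤ.≤ d
interior-bound f z∈ f≤d = ℤP.i<j⇒suc[i]≤j (ι-cancel-< {lo f} (ℚP.<-≤-trans (val-open f z∈) f≤d))

data Reading {n} (f : Form n) (d : ℤ) : Set where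
  redundant  : (∀ y → UnitCube y → val f y ℚ.≤ ι d) → Reading f d
  comparison : (a b : Fin n) → (∀ y → (val f y ℚ.≤ ι d) ⇔ (y a ℚ.≤ y b)) → Reading f d

-- The double inequalities f ≤ lo f + 1 pass through the centre.  Those with
-- equal signs, y_i + y_j ≤ 1 and y_i + y_j ≥ 1, cannot be tight at the centre
-- and at a point q of the closed negative orthant at once; the others are
-- comparisons.
through-centre : ∀ {n} s t (i j : Fin n) {q : Pt n} → (∀ l → q l ℚ.≤ 0ℚ) →
  let f = double s t i j in
  (val f half ≡ ι (ℤ.suc (lo f)) → val f q ≡ ι (ℤ.suc (lo f))) → Reading f (ℤ.suc (lo f))
through-centre plus plus i j {q} q≤0 tight = ⊥-elim (ℚP.≤⇒≤ᵇ (subst (ℚ._≤ 0ℚ) (tight refl) sum≤0))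
  where
  sum≤0 : sg plus ℚ.* q i ℚ.+ sg plus ℚ.* q j ℚ.≤ 0ℚ
  sum≤0 = subst (ℚ._≤ 0ℚ) (cong₂ ℚ._+_ (sym (ℚP.*-identityˡ (q i))) (sym (ℚP.*-identityˡ (q j))))
                (ℚP.+-mono-≤ (q≤0 i) (q≤0 j))
through-centre minus minus i j {q} q≤0 tight = ⊥-elim (ℚP.≤⇒≤ᵇ (subst (0ℚ ℚ.≤_) (tight refl) sum≥0))
  where
  negated≥0 : ∀ l → 0ℚ ℚ.≤ sg minus ℚ.* q l
  negated≥0 l = slack-≤ (solve 1 (λ q → q :- con 0ℚ := con 0ℚ :- con (ℚ.- 1ℚ) :* q) refl (q l)) (q≤0 l)
  sum≥0 : 0ℚ ℚ.≤ sg minus ℚ.* q i ℚ.+ sg minus ℚ.* q j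
  sum≥0 = ℚP.+-mono-≤ (negated≥0 i) (negated≥0 j)
through-centre plus minus i j _ _ = comparison i j λ y →
  mk⇔ (slack-≤ (same-slack (y i) (y j))) (slack-≤ (sym (same-slack (y i) (y j))))
  where
  same-slack : ∀ a b → (sg plus ℚ.* a ℚ.+ sg minus ℚ.* b) ℚ.- 0ℚ ≡ a ℚ.- b
  same-slack = solve 2 (λ a b → con 1ℚ :* a :+ con (ℚ.- 1ℚ) :* b :- con 0ℚ := a :- b) refl
through-centre minus plus i j _ _ = comparison j i λ y →
  mk⇔ (slack-≤ (same-slack (y i) (y j))) (slack-≤ (sym (same-slack (y i) (y j))))
  where
  same-slack : ∀ a b → (sg minus ℚ.* a ℚ.+ sg plus ℚ.* b) ℚ.- 0ℚ ≡ b ℚ.- a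
  same-slack = solve 2 (λ a b → con (ℚ.- 1ℚ) :* a :+ con 1ℚ :* b :- con 0ℚ := b :- a) refl

classify : ∀ {n} (f : Form n) (d : ℤ) {z q : Pt n} →
  OpenUnitCube z → val f z ℚ.≤ ι d →
  (∀ l → q l ℚ.≤ 0ℚ) → (val f half ≡ ι d → val f q ≡ ι d) → Reading f d
classify f d z∈ z-valid q≤0 tight with hi f ℤ.≤? d
... | yes hi≤d = redundant (λ y y∈ → ℚP.≤-trans (val-closed f y∈) (ι-mono-≤ hi≤d))
... | no  hi≰d = at-most-hi f (interior-bound f z∈ z-valid) hi≰d q≤0 tight
  where
  at-most-hi : ∀ {n} (f : Form n) {d : ℤ} {q : Pt n} → ℤ.suc (lo f) ℤ.≤ d → ¬ (hi f ℤ.≤ d) →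
    (∀ l → q l ℚ.≤ 0ℚ) → (val f half ≡ ι d → val f q ≡ ι d) → Reading f d
  at-most-hi (single s i)     lo<d hi≰d _ _ = ⊥-elim (hi≰d lo<d)
  at-most-hi (double s t i j) lo<d hi≰d q≤0 tight
    with ℤP.≤∧≮⇒≡ lo<d (λ lo+1<d → hi≰d (ℤP.i<j⇒suc[i]≤j lo+1<d))
  ... | refl = through-centre s t i j q≤0 tight

-- Each sign selects an affine bijection [κ, κ + 1] → [0, 1] with integral
-- coefficients: plus is t ↦ t - κ, minus is t ↦ κ + 1 - t.  The corner is
-- the end point sent to 0.
shift : Sign → ℤ → ℤ
shift plus  κ = ℤ.- κ
shift minus κ = κ ℤ.+ + 1

corner : Sign → ℤ → ℤ
corner plus  κ = κ
corner minus κ = κ ℤ.+ + 1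

unit-coord : Sign → ℤ → ℚ → ℚ
unit-coord s κ t = sg s ℚ.* t ℚ.+ ι (shift s κ)

unit-coord-plus : ∀ κ t → unit-coord plus κ t ≡ t ℚ.- ι κ
unit-coord-plus κ t = cong₂ ℚ._+_ (ℚP.*-identityˡ t) (ι-neg κ)

unit-coord-minus : ∀ κ t → unit-coord minus κ t ≡ (ι κ ℚ.+ 1ℚ) ℚ.- t
unit-coord-minus κ t = trans (cong (sg minus ℚ.* t ℚ.+_) (ι-+ κ (+ 1)))
  (solve 2 (λ t K → con (ℚ.- 1ℚ) :* t :+ (K :+ con 1ℚ) := (K :+ con 1ℚ) :- t) refl t (ι κ))

unit-coord-inverse : ∀ s κ t → t ≡ ι (corner s κ) ℚ.+ sg s ℚ.* unit-coord s κ t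
unit-coord-inverse plus κ t = sym (begin
  ι κ ℚ.+ sg plus ℚ.* unit-coord plus κ t ≡⟨ cong (λ u → ι κ ℚ.+ sg plus ℚ.* u) (unit-coord-plus κ t) ⟩
  ι κ ℚ.+ sg plus ℚ.* (t ℚ.- ι κ)         ≡⟨ solve 2 (λ K t → K :+ con 1ℚ :* (t :- K) := t) refl (ι κ) t ⟩
  t                                        ∎)
  where open ≡-Reasoning
unit-coord-inverse minus κ t = sym (begin
  ι (κ ℤ.+ + 1) ℚ.+ sg minus ℚ.* unit-coord minus κ t
    ≡⟨ cong₂ (λ c u → c ℚ.+ sg minus ℚ.* u) (ι-+ κ (+ 1)) (unit-coord-minus κ t) ⟩
  (ι κ ℚ.+ 1ℚ) ℚ.+ sg minus ℚ.* ((ι κ ℚ.+ 1ℚ) ℚ.- t)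
    ≡⟨ solve 2 (λ K t → (K :+ con 1ℚ) :+ con (ℚ.- 1ℚ) :* ((K :+ con 1ℚ) :- t) := t) refl (ι κ) t ⟩
  t ∎)
  where open ≡-Reasoning

plus-at-0 : ∀ κ t → 0ℚ ℚ.- unit-coord plus κ t ≡ ι κ ℚ.- t
plus-at-0 κ t = trans (cong (λ u → 0ℚ ℚ.- u) (unit-coord-plus κ t))
                      (solve 2 (λ K t → con 0ℚ :- (t :- K) := K :- t) refl (ι κ) t)

plus-at-1 : ∀ κ t → unit-coord plus κ t ℚ.- 1ℚ ≡ t ℚ.- (ι κ ℚ.+ 1ℚ)
plus-at-1 κ t = trans (cong (ℚ._- 1ℚ) (unit-coord-plus κ t))
                      (solve 2 (λ K t → (t :- K) :- con 1ℚ := t :- (K :+ con 1ℚ)) refl (ι κ) t)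

minus-at-0 : ∀ κ t → 0ℚ ℚ.- unit-coord minus κ t ≡ t ℚ.- (ι κ ℚ.+ 1ℚ)
minus-at-0 κ t = trans (cong (λ u → 0ℚ ℚ.- u) (unit-coord-minus κ t))
                       (solve 2 (λ K t → con 0ℚ :- ((K :+ con 1ℚ) :- t) := t :- (K :+ con 1ℚ)) refl (ι κ) t)

minus-at-1 : ∀ κ t → unit-coord minus κ t ℚ.- 1ℚ ≡ ι κ ℚ.- t
minus-at-1 κ t = trans (cong (ℚ._- 1ℚ) (unit-coord-minus κ t))
                       (solve 2 (λ K t → ((K :+ con 1ℚ) :- t) :- con 1ℚ := K :- t) refl (ι κ) t)

unit-coord-interval : ∀ s κ t →
  ((0ℚ ℚ.≤ unit-coord s κ t) × (unit-coord s κ t ℚ.≤ 1ℚ)) ⇔ ((ι κ ℚ.≤ t) × (t ℚ.≤ ι κ ℚ.+ 1ℚ))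
unit-coord-interval plus κ t = mk⇔
  (λ (0≤u , u≤1) → slack-≤ (plus-at-0 κ t) 0≤u , slack-≤ (plus-at-1 κ t) u≤1)
  (λ (κ≤t , t≤κ+1) → slack-≤ (sym (plus-at-0 κ t)) κ≤t , slack-≤ (sym (plus-at-1 κ t)) t≤κ+1)
unit-coord-interval minus κ t = mk⇔
  (λ (0≤u , u≤1) → slack-≤ (minus-at-1 κ t) u≤1 , slack-≤ (minus-at-0 κ t) 0≤u)
  (λ (κ≤t , t≤κ+1) → slack-≤ (sym (minus-at-0 κ t)) t≤κ+1 , slack-≤ (sym (minus-at-1 κ t)) κ≤t)

unit-coord-open : ∀ s κ t → ι κ ℚ.< t → t ℚ.< ι κ ℚ.+ 1ℚ →
  (0ℚ ℚ.< unit-coord s κ t) × (unit-coord s κ t ℚ.< 1ℚ)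
unit-coord-open plus  κ t κ<t t<κ+1 = slack-< (sym (plus-at-0 κ t)) κ<t , slack-< (sym (plus-at-1 κ t)) t<κ+1
unit-coord-open minus κ t κ<t t<κ+1 = slack-< (sym (minus-at-0 κ t)) t<κ+1 , slack-< (sym (minus-at-1 κ t)) κ<t

unit-coord-midpoint : ∀ s κ → unit-coord s κ (ι κ ℚ.+ ½) ≡ ½
unit-coord-midpoint plus  κ = trans (unit-coord-plus κ (ι κ ℚ.+ ½))
  (solve 1 (λ K → (K :+ con ½) :- K := con ½) refl (ι κ))
unit-coord-midpoint minus κ = trans (unit-coord-minus κ (ι κ ℚ.+ ½))
  (solve 1 (λ K → (K :+ con 1ℚ) :- (K :+ con ½) := con ½) refl (ι κ))

toward : ℤ → ℤ → Sign
toward κ π with κ ℤ.<? π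
... | yes _ = minus
... | no  _ = plus

toward-nonpos : ∀ κ π → unit-coord (toward κ π) κ (ι π) ℚ.≤ 0ℚ
toward-nonpos κ π with κ ℤ.<? π
... | yes κ<π = slack-≤ same (ι-mono-≤ (ℤP.i<j⇒suc[i]≤j κ<π))
  where
  same : ι (ℤ.suc κ) ℚ.- ι π ≡ unit-coord minus κ (ι π) ℚ.- 0ℚ
  same = begin
    ι (+ 1 ℤ.+ κ) ℚ.- ι π        ≡⟨ cong (ℚ._- ι π) (ι-+ (+ 1) κ) ⟩
    (1ℚ ℚ.+ ι κ) ℚ.- ι π         ≡⟨ solve 2 (λ K p → (con 1ℚ :+ K) :- p := ((K :+ con 1ℚ) :- p) :- con 0ℚ) refl (ι κ) (ι π) ⟩
    ((ι κ ℚ.+ 1ℚ) ℚ.- ι π) ℚ.- 0ℚ ≡⟨ cong (ℚ._- 0ℚ) (sym (unit-coord-minus κ (ι π))) ⟩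
    unit-coord minus κ (ι π) ℚ.- 0ℚ ∎
    where open ≡-Reasoning
... | no κ≮π = slack-≤ same (ι-mono-≤ (ℤP.≮⇒≥ κ≮π))
  where
  same : ι π ℚ.- ι κ ≡ unit-coord plus κ (ι π) ℚ.- 0ℚ
  same = trans (solve 2 (λ p K → p :- K := (p :- K) :- con 0ℚ) refl (ι π) (ι κ))
               (cong (ℚ._- 0ℚ) (sym (unit-coord-plus κ (ι π))))

centre : ∀ {n} → ZVec n → Pt n
centre k i = ι (k i) ℚ.+ ½

module Reflection {n} (σ : Fin n → Sign) (k : ZVec n) where

  reflection-matrix : ZMat n n
  reflection-matrix i j = sgn (σ i) ℤ.* δ i j

  reflection-shift : ZVec n
  reflection-shift i = shift (σ i) (k i)

  Φ : Pt n → Pt n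
  Φ = affine reflection-matrix reflection-shift

  Φ-coord : ∀ x i → Φ x i ≡ unit-coord (σ i) (k i) (x i)
  Φ-coord x i = cong (ℚ._+ ι (shift (σ i) (k i))) (Σℚ-δ (sgn (σ i)) i x)

  -- The matrix is a signed identity, hence its own inverse.
  reflection-unimodular : Unimodular reflection-matrix
  reflection-unimodular = reflection-matrix , involutive , involutive
    where
    involutive : ∀ i j → (reflection-matrix · reflection-matrix) i j ≡ δ i j
    involutive i j = trans (Σℤ-δ (sgn (σ i)) i (λ l → reflection-matrix l j)) (sgn-involutive (σ i) (δ i j))

  cube⇔unit-cube : ∀ x → Cube k x ⇔ UnitCube (Φ x)
  cube⇔unit-cube x = mk⇔
    (λ x∈ i → subst (λ u → (0ℚ ℚ.≤ u) × (u ℚ.≤ 1ℚ)) (sym (Φ-coord x i))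
                    (from (unit-coord-interval (σ i) (k i) (x i)) (x∈ i)))
    (λ Φx∈ i → to (unit-coord-interval (σ i) (k i) (x i))
                  (subst (λ u → (0ℚ ℚ.≤ u) × (u ℚ.≤ 1ℚ)) (Φ-coord x i) (Φx∈ i)))

  inside⇒open : ∀ x → (∀ i → (ι (k i) ℚ.< x i) × (x i ℚ.< ι (k i) ℚ.+ 1ℚ)) → OpenUnitCube (Φ x)
  inside⇒open x x-inside i = subst (λ u → (0ℚ ℚ.< u) × (u ℚ.< 1ℚ)) (sym (Φ-coord x i))
    (unit-coord-open (σ i) (k i) (x i) (proj₁ (x-inside i)) (proj₂ (x-inside i)))

  Φ-centre : ∀ i → Φ (centre k) i ≡ ½
  Φ-centre i = trans (Φ-coord (centre k) i) (unit-coord-midpoint (σ i) (k i))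

  Φ-coord-injective : ∀ x y i → Φ x i ≡ Φ y i → x i ≡ y i
  Φ-coord-injective x y i Φx≡Φy = begin
    x i                                                      ≡⟨ unit-coord-inverse (σ i) (k i) (x i) ⟩
    ι (corner (σ i) (k i)) ℚ.+ sg (σ i) ℚ.* unit-coord (σ i) (k i) (x i)
      ≡⟨ cong (λ u → ι (corner (σ i) (k i)) ℚ.+ sg (σ i) ℚ.* u) (trans (sym (Φ-coord x i)) (trans Φx≡Φy (Φ-coord y i))) ⟩
    ι (corner (σ i) (k i)) ℚ.+ sg (σ i) ℚ.* unit-coord (σ i) (k i) (y i) ≡⟨ sym (unit-coord-inverse (σ i) (k i) (y i)) ⟩
    y i                                                      ∎
    where open ≡-Reasoning

  corner-point : ZVec n
  corner-point i = corner (σ i) (k i)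

  val-decompose : ∀ (f : Form n) x → val f x ≡ ι (valℤ f corner-point) ℚ.+ val (twist σ f) (Φ x)
  val-decompose f x = begin
    val f x
      ≡⟨ val-cong f (λ i → trans (unit-coord-inverse (σ i) (k i) (x i))
                                 (cong (λ u → ι (corner-point i) ℚ.+ sg (σ i) ℚ.* u) (sym (Φ-coord x i)))) ⟩
    val f (λ i → lattice-point corner-point i ℚ.+ sg (σ i) ℚ.* Φ x i)
      ≡⟨ val-twist f σ (lattice-point corner-point) (Φ x) ⟩
    val f (lattice-point corner-point) ℚ.+ val (twist σ f) (Φ x)
      ≡⟨ cong (ℚ._+ val (twist σ f) (Φ x)) (val-lattice f corner-point) ⟩
    ι (valℤ f corner-point) ℚ.+ val (twist σ f) (Φ x) ∎
    where open ≡-Reasoning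

  transfer-slack : ∀ (f : Form n) (W : ℤ) x →
    val f x ℚ.- ι W ≡ val (twist σ f) (Φ x) ℚ.- ι (W ℤ.- valℤ f corner-point)
  transfer-slack f W x = begin
    val f x ℚ.- ι W
      ≡⟨ cong (ℚ._- ι W) (val-decompose f x) ⟩
    (ι C ℚ.+ val (twist σ f) (Φ x)) ℚ.- ι W
      ≡⟨ solve 3 (λ C g W → (C :+ g) :- W := g :- (W :- C)) refl (ι C) (val (twist σ f) (Φ x)) (ι W) ⟩
    val (twist σ f) (Φ x) ℚ.- (ι W ℚ.- ι C)
      ≡⟨ cong (λ u → val (twist σ f) (Φ x) ℚ.- u) (sym (ι-- W C)) ⟩
    val (twist σ f) (Φ x) ℚ.- ι (W ℤ.- C) ∎
    where
    open ≡-Reasoning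
    C : ℤ
    C = valℤ f corner-point

module FullDimensional {n} {S : Region n} (S-full : FullDim S) where

  c : Pt n
  c = proj₁ S-full

  ε : ℚ
  ε = proj₁ (proj₂ S-full)

  -- Half the radius of the box around c; moving by η keeps points inside it.
  η : ℚ
  η = ε ℚ.* ½

  η>0 : 0ℚ ℚ.< η
  η>0 = ℚP.*-monoˡ-<-pos ½ (proj₁ (proj₂ (proj₂ S-full)))

  η<ε : η ℚ.< ε
  η<ε = slack-< (solve 1 (λ ε → con 0ℚ :- ε :* con ½ := ε :* con ½ :- ε) refl ε) η>0

  below-strict : ∀ t → t ℚ.- η ℚ.< t
  below-strict t = slack-< (solve 2 (λ t η → con 0ℚ :- η := (t :- η) :- t) refl t η) η>0

  above-strict : ∀ t → t ℚ.< t ℚ.+ η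
  above-strict t = slack-< (solve 2 (λ t η → con 0ℚ :- η := t :- (t :+ η)) refl t η) η>0

  near : ∀ y → (∀ i → (c i ℚ.- η ℚ.≤ y i) × (y i ℚ.≤ c i ℚ.+ η)) → S y
  near y close = proj₂ (proj₂ (proj₂ S-full)) y λ i →
    ℚP.<-≤-trans (ℚP.+-monoʳ-< (c i) (ℚP.neg-antimono-< η<ε)) (proj₁ (close i)) ,
    ℚP.≤-<-trans (proj₂ (close i)) (ℚP.+-monoʳ-< (c i) η<ε)

  within : ∀ t → (t ℚ.- η ℚ.≤ t) × (t ℚ.≤ t ℚ.+ η)
  within t = ℚP.<⇒≤ (below-strict t) , ℚP.<⇒≤ (above-strict t)

  spread : ∀ t → t ℚ.- η ℚ.≤ t ℚ.+ η
  spread t = ℚP.<⇒≤ (ℚP.<-trans (below-strict t) (above-strict t))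

  c∈S : S c
  c∈S = near c (λ i → within (c i))

  raised∈S : S (λ i → c i ℚ.+ η)
  raised∈S = near _ (λ i → spread (c i) , ℚP.≤-refl)

  lowered∈S : S (λ i → c i ℚ.- η)
  lowered∈S = near _ (λ i → ℚP.≤-refl , spread (c i))

  bump : Fin n → Pt n
  bump i = updateAt c i (ℚ._+ η)

  bump∈S : ∀ i → S (bump i)
  bump∈S i = near (bump i) close
    where
    close : ∀ j → (c j ℚ.- η ℚ.≤ bump i j) × (bump i j ℚ.≤ c j ℚ.+ η)
    close j with j FinP.≟ i
    ... | yes refl = subst (λ u → (c j ℚ.- η ℚ.≤ u) × (u ℚ.≤ c j ℚ.+ η)) (sym (updateAt-updates j c))
                           (spread (c j) , ℚP.≤-refl)
    ... | no j≢i = subst (λ u → (c j ℚ.- η ℚ.≤ u) × (u ℚ.≤ c j ℚ.+ η)) (sym (updateAt-minimal j i c j≢i))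
                         (within (c j))

module MaximalCell {n m : ℕ} (A : Fin m → ZVec n) (w : Fin m → ℤ) (Q : Region n)
  (A∈B : ∀ r → InB (A r)) (P-lattice : IsLatticePolytope (HPoly A w))
  (Q-cell : IsMaximalCell (HPoly A w) Q) where

  P : Region n
  P = HPoly A w

  k : ZVec n
  k = proj₁ Q-cell

  Q≐cell : Q ≐ Cell P k
  Q≐cell = proj₂ (proj₂ Q-cell)

  open FullDimensional (proj₁ (proj₂ Q-cell))

  c-inside : ∀ i → (ι (k i) ℚ.< c i) × (c i ℚ.< ι (k i) ℚ.+ 1ℚ)
  c-inside i = ℚP.≤-<-trans (proj₁ (proj₂ lowered∈S i)) (below-strict (c i)) ,
               ℚP.<-≤-trans (above-strict (c i)) (proj₂ (proj₂ raised∈S i))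

  facet : Fin m → Form n
  facet r = form (A∈B r)

  module Facets (σ : Fin n → Sign) where
    open Reflection σ k public

    g : Fin m → Form n
    g r = twist σ (facet r)

    d : Fin m → ℤ
    d r = w r ℤ.- valℤ (facet r) corner-point

    facet-slack : ∀ r x → ⟨ A r , x ⟩ ℚ.- ι (w r) ≡ val (g r) (Φ x) ℚ.- ι (d r)
    facet-slack r x = trans (cong (ℚ._- ι (w r)) (form-val (A∈B r) x)) (transfer-slack (facet r) (w r) x)

    c-open : OpenUnitCube (Φ c)
    c-open = inside⇒open c c-inside

    c-valid : ∀ r → val (g r) (Φ c) ℚ.≤ ι (d r)
    c-valid r = slack-≤ (facet-slack r c) (proj₁ c∈S r)

    -- Every facet inequality holds at the centre of the cube, since the
    -- interior point forces d r ≥ lo (g r) + 1.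
    centre-valid : ∀ r → ⟨ A r , centre k ⟩ ℚ.≤ ι (w r)
    centre-valid r = slack-≤ (sym (facet-slack r (centre k))) (begin
      val (g r) (Φ (centre k)) ≡⟨ val-cong (g r) Φ-centre ⟩
      val (g r) half           ≤⟨ val-half (g r) ⟩
      ι (ℤ.suc (lo (g r)))     ≤⟨ ι-mono-≤ {b = d r} (interior-bound (g r) c-open (c-valid r)) ⟩
      ι (d r)                  ∎)
      where open ℚP.≤-Reasoning

  centre∈P : P (centre k)
  centre∈P = Facets.centre-valid (λ _ → plus)

  supporting-vertex : Σ (ZVec n) λ v →
    ∀ r → ⟨ A r , centre k ⟩ ≡ ι (w r) → ⟨ A r , lattice-point v ⟩ ≡ ι (w r)
  supporting-vertex = generators (proj₁ support) , λ r → proj₂ support (A r) (ι (w r)) (λ y y∈P → y∈P r)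
    where
    generators : Fin (proj₁ P-lattice) → ZVec n
    generators = proj₁ (proj₂ P-lattice)
    support : Σ (Fin (proj₁ P-lattice)) λ a → ∀ (v : ZVec n) (W : ℚ) →
      (∀ y → P y → ⟨ v , y ⟩ ℚ.≤ W) → ⟨ v , centre k ⟩ ≡ W → ⟨ v , lattice-point (generators a) ⟩ ≡ W
    support = supporting-generator generators (proj₂ (proj₂ P-lattice)) centre∈P

  vertex : ZVec n
  vertex = proj₁ supporting-vertex

  orientation : Fin n → Sign
  orientation i = toward (k i) (vertex i)

  open Facets orientation public

  vertex-nonpos : ∀ i → Φ (lattice-point vertex) i ℚ.≤ 0ℚ
  vertex-nonpos i = subst (ℚ._≤ 0ℚ) (sym (Φ-coord (lattice-point vertex) i)) (toward-nonpos (k i) (vertex i))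

  reading : ∀ r → Reading (g r) (d r)
  reading r = classify (g r) (d r) c-open (c-valid r) vertex-nonpos tight-at-vertex
    where
    tight-at-vertex : val (g r) half ≡ ι (d r) → val (g r) (Φ (lattice-point vertex)) ≡ ι (d r)
    tight-at-vertex tight-at-half = slack-≡ (facet-slack r (lattice-point vertex))
      (proj₂ supporting-vertex r
        (slack-≡ (sym (facet-slack r (centre k))) (trans (val-cong (g r) Φ-centre) tight-at-half)))

  _≼_ : Fin n → Fin n → Set
  i ≼ j = ∀ x → Q x → Φ x i ℚ.≤ Φ x j

  -- Distinct coordinates are separated on Q: raising coordinate i of c
  -- changes y_i but not y_j.
  separated : ∀ {i j} → i ≢ j → ¬ (∀ x → Q x → Φ x i ≡ Φ x j)
  separated {i} {j} i≢j yᵢ≡yⱼ = ℚP.<-irrefl (sym bump-unmoved) (above-strict (c i))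
    where
    c∈Q : Q c
    c∈Q = from (Q≐cell c) c∈S
    bump∈Q : Q (bump i)
    bump∈Q = from (Q≐cell (bump i)) (bump∈S i)
    same-j : Φ (bump i) j ≡ Φ c j
    same-j = trans (Φ-coord (bump i) j)
      (trans (cong (unit-coord (orientation j) (k j)) (updateAt-minimal j i {f = ℚ._+ η} c (λ j≡i → i≢j (sym j≡i))))
             (sym (Φ-coord c j)))
    bump-unmoved : c i ℚ.+ η ≡ c i
    bump-unmoved = trans (sym (updateAt-updates i {f = ℚ._+ η} c))
      (Φ-coord-injective (bump i) c i (trans (yᵢ≡yⱼ (bump i) bump∈Q) (trans same-j (sym (yᵢ≡yⱼ c c∈Q)))))

  ≼-antisym : ∀ {i j} → i ≼ j → j ≼ i → i ≡ j
  ≼-antisym {i} {j} i≼j j≼i = decidable-stable (i FinP.≟ j)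
    (λ i≢j → separated i≢j (λ x x∈Q → ℚP.≤-antisym (i≼j x x∈Q) (j≼i x x∈Q)))

  ≼-isPartialOrder : IsPartialOrder _≡_ _≼_
  ≼-isPartialOrder = record
    { isPreorder = record
      { isEquivalence = isEquivalence
      ; reflexive     = λ { refl x _ → ℚP.≤-refl }
      ; trans         = λ i≼j j≼l x x∈Q → ℚP.≤-trans (i≼j x x∈Q) (j≼l x x∈Q)
      }
    ; antisym = ≼-antisym
    }

  -- Φ maps Q onto the order polytope: the cube goes to [0,1]ⁿ, and each
  -- facet inequality is redundant there or is one of the relations of ≼.
  Q⇔order-polytope : ∀ x → Q x ⇔ OrderPolytope _≼_ (Φ x)
  Q⇔order-polytope x = mk⇔ into onto
    where
    into : Q x → OrderPolytope _≼_ (Φ x)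
    into x∈Q = to (cube⇔unit-cube x) (proj₂ (to (Q≐cell x) x∈Q)) , λ i j i≼j → i≼j x x∈Q
    onto : OrderPolytope _≼_ (Φ x) → Q x
    onto (Φx∈unit , monotone) = from (Q≐cell x) ((λ r → facet-holds r (reading r)) , from (cube⇔unit-cube x) Φx∈unit)
      where
      facet-holds : ∀ r → Reading (g r) (d r) → ⟨ A r , x ⟩ ℚ.≤ ι (w r)
      facet-holds r (redundant holds) = slack-≤ (sym (facet-slack r x)) (holds (Φ x) Φx∈unit)
      facet-holds r (comparison a b g≤d⇔a≤b) =
        slack-≤ (sym (facet-slack r x)) (from (g≤d⇔a≤b (Φ x)) (monotone a b a≼b))
        where
        a≼b : a ≼ b
        a≼b y y∈Q = to (g≤d⇔a≤b (Φ y)) (slack-≤ (facet-slack r y) (proj₁ (to (Q≐cell y) y∈Q) r))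

lemma3p8 : (n m : ℕ) (A : Fin m → ZVec n) (w : Fin m → ℤ) (Q : Region n) →
    (∀ r → InB (A r)) →
    IsLatticePolytope (HPoly A w) →
    FullDim (HPoly A w) →
    IsMaximalCell (HPoly A w) Q →
    IsOrderPolytopeUpToLattice Q
lemma3p8 n m A w Q A∈B P-lattice _ Q-cell =
  _≼_ , ≼-isPartialOrder , reflection-matrix , reflection-shift , reflection-unimodular , Q⇔order-polytope
  where open MaximalCell A w Q A∈B P-lattice Q-cell
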